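{- Let $n \geq 1$ and $w \in S_n$, and let $\phi(w) = p_1 \cdots p_n$ be the associated word defined below. Then \[\operatorname{dep}(w) = \sum_{k:\, p_k = D} k \;-\; \sum_{i:\, p_i = U} i.\]
   Context: $S_n$ is the symmetric group on $\{1,\dots,n\}$. For $w \in S_n$, the depth is $\operatorname{dep}(w) = \sum_{i:\, w(i) > i} (w(i) - i)$ (half of the total displacement $\sum_{i=1}^n |w(i)-i|$). The word $\phi(w) = p_1 \cdots p_n$ over the alphabet $\{U, D, H\}$ is defined by: $p_i = U$ if $w^{ -1}(i) > i$ and $w(i) > i$; $p_i = D$ if $w^{ -1}(i) < i$ and $w(i) < i$; and $p_i = H$ otherwise. (This word is always a Motzkin path, i.e., the subword on the letters $U, D$ is a balanced parenthesization with $U$ as opening and $D$ as closing symbol.) -}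

module Defs where

open import Data.Nat using (ℕ; zero; suc; _+_; _∸_; _<ᵇ_)
open import Data.Fin using (Fin; toℕ)
open import Data.Fin.Permutation using (Permutation′; _⟨$⟩ʳ_; _⟨$⟩ˡ_)
open import Data.Bool using (Bool; true; false; if_then_else_; _∧_)
open import Data.List using (List; map; filterᵇ)
open import Data.Nat.ListAction using (sum)
open import Data.Vec.Functional using (Vector)
open import Data.List using (allFin)
import Data.Integer as ℤ

-- Positions/values are Fin n; the element i : Fin n stands for the integer toℕ i + 1.
pos : ∀ {n} → Fin n → ℕ
pos i = suc (toℕ i)

dep : ∀ {n} → Permutation′ n → ℕ
dep {n} w = sum (map (λ i → pos (w ⟨$⟩ʳ i) ∸ pos i)
                     (filterᵇ (λ i → pos i <ᵇ pos (w ⟨$⟩ʳ i)) (allFin n)))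

data Step : Set where
  U D H : Step

isU isD : Step → Bool
isU U = true
isU _ = false
isD D = true
isD _ = false

φletter : ∀ {n} → Permutation′ n → Fin n → Step
φletter w i =
  if (pos i <ᵇ pos (w ⟨$⟩ˡ i)) ∧ (pos i <ᵇ pos (w ⟨$⟩ʳ i)) then U
  else if (pos (w ⟨$⟩ˡ i) <ᵇ pos i) ∧ (pos (w ⟨$⟩ʳ i) <ᵇ pos i) then D
  else H

φ : ∀ {n} → Permutation′ n → Vector Step n
φ w = φletter w

posSum : ∀ {n} → (Step → Bool) → Vector Step n → ℕ
posSum {n} sel p = sum (map pos (filterᵇ (λ k → sel (p k)) (allFin n)))

-- Write a = w⁻¹(i), b = w(i) and x = i.  Reindexing by i ↦ w(i) shows
-- dep(w) + Σ_{x < b} x = Σ_{x < b} b = Σ_{a < x} x, so it suffices that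
-- Σ_{a < x} x + Σ_{p = U} x = Σ_{p = D} x + Σ_{x < b} x, and this holds term by term:
-- a position is fixed by w exactly when it is fixed by w⁻¹, and otherwise each of
-- the four sign patterns of (x − a, b − x) gives the same contribution to both sides.
module Submission where

open import Defs
open import Data.Nat using (ℕ; _≥_; zero; suc; _+_; _∸_; _<ᵇ_; _≟_)
open import Data.Fin.Permutation using (Permutation′; _⟨$⟩ʳ_; _⟨$⟩ˡ_; inverseˡ; inverseʳ)
open import Data.Integer using (+_; _-_; _⊖_)
open import Relation.Binary.PropositionalEquality
  using (_≡_; _≢_; refl; sym; trans; cong; module ≡-Reasoning)

open import Data.Bool using (Bool; true; false; not; if_then_else_; _∧_)
open import Data.Empty using (⊥-elim)
open import Data.Fin using (Fin) renaming (zero to fzero; suc to fsuc)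
open import Data.Fin.Properties using (toℕ-injective)
open import Data.Integer.Properties using (m-n≡m⊖n; ⊖-≥)
open import Data.List using (map; filterᵇ; allFin; tabulate)
open import Data.Nat.ListAction using (sum)
open import Data.Nat.Properties
  using (<ᵇ-reflects-<; <⇒≤; <-asym; n≮n; ≮⇒≥; ≤-antisym; m∸n+n≡m; m+n∸n≡m; m≤n+m;
         +-identityʳ; +-cancelʳ-≡; suc-injective; +-0-commutativeMonoid; +-commutativeSemigroup)
open import Algebra.Properties.CommutativeSemigroup +-commutativeSemigroup using (xy∙z≈xz∙y)
open import Algebra.Properties.CommutativeMonoid.Sum +-0-commutativeMonoid
  using (sum-syntax; ∑-distrib-+; ∑-permute; sum-cong-≗)
open import Relation.Nullary using (yes; no)
open import Relation.Nullary.Reflects using (ofʸ; ofⁿ)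

[_]·_ : Bool → ℕ → ℕ
[ b ]· m = if b then m else 0

sum-filterᵇ-tabulate : ∀ {a} {A : Set a} {n} (p : A → Bool) (f : A → ℕ) (g : Fin n → A) →
  sum (map f (filterᵇ p (tabulate g))) ≡ ∑[ i < n ] [ p (g i) ]· f (g i)
sum-filterᵇ-tabulate {n = zero}  p f g = refl
sum-filterᵇ-tabulate {n = suc n} p f g with p (g fzero)
... | true  = cong (_+_ (f (g fzero))) (sum-filterᵇ-tabulate p f (λ i → g (fsuc i)))
... | false = sum-filterᵇ-tabulate p f (λ i → g (fsuc i))

sum-filterᵇ-allFin : ∀ {n} (p : Fin n → Bool) (f : Fin n → ℕ) →
  sum (map f (filterᵇ p (allFin n))) ≡ ∑[ i < n ] [ p i ]· f i
sum-filterᵇ-allFin p f = sum-filterᵇ-tabulate p f (λ i → i)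

∑-permute-graph : ∀ {n} (π : Permutation′ n) (g : Fin n → Fin n → ℕ) →
  ∑[ j < n ] g (π ⟨$⟩ˡ j) j ≡ ∑[ i < n ] g i (π ⟨$⟩ʳ i)
∑-permute-graph π g = trans (∑-permute (λ j → g (π ⟨$⟩ˡ j) j) π)
                            (sum-cong-≗ (λ i → cong (λ k → g k (π ⟨$⟩ʳ i)) (inverseˡ π)))

fixedˡ⇒fixedʳ : ∀ {n} (π : Permutation′ n) {i} → π ⟨$⟩ˡ i ≡ i → π ⟨$⟩ʳ i ≡ i
fixedˡ⇒fixedʳ π {i} e = trans (cong (π ⟨$⟩ʳ_) (sym e)) (inverseʳ π)

fixedʳ⇒fixedˡ : ∀ {n} (π : Permutation′ n) {i} → π ⟨$⟩ʳ i ≡ i → π ⟨$⟩ˡ i ≡ i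
fixedʳ⇒fixedˡ π {i} e = trans (cong (π ⟨$⟩ˡ_) (sym e)) (inverseˡ π)

pos-injective : ∀ {n} {i j : Fin n} → pos i ≡ pos j → i ≡ j
pos-injective e = toℕ-injective (suc-injective e)

n<ᵇn≡false : ∀ n → (n <ᵇ n) ≡ false
n<ᵇn≡false n with n <ᵇ n | <ᵇ-reflects-< n n
... | true  | ofʸ n<n = ⊥-elim (n≮n n n<n)
... | false | ofⁿ _   = refl

<ᵇ-flip : ∀ {m n} → m ≢ n → (n <ᵇ m) ≡ not (m <ᵇ n)
<ᵇ-flip {m} {n} m≢n with m <ᵇ n | <ᵇ-reflects-< m n | n <ᵇ m | <ᵇ-reflects-< n m
... | true  | ofʸ m<n | true  | ofʸ n<m = ⊥-elim (<-asym m<n n<m)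
... | true  | _       | false | _       = refl
... | false | _       | true  | _       = refl
... | false | ofⁿ m≮n | false | ofⁿ n≮m = ⊥-elim (m≢n (≤-antisym (≮⇒≥ n≮m) (≮⇒≥ m≮n)))

-- φletter w i unfolds to letter (pos (w ⟨$⟩ˡ i)) (pos (w ⟨$⟩ʳ i)) (pos i).
letter : (a b x : ℕ) → Step
letter a b x = if (x <ᵇ a) ∧ (x <ᵇ b) then U else if (a <ᵇ x) ∧ (b <ᵇ x) then D else H

letter-balance : ∀ a b x → (a ≡ x → b ≡ x) → (b ≡ x → a ≡ x) →
  [ a <ᵇ x ]· x + [ isU (letter a b x) ]· x ≡ [ isD (letter a b x) ]· x + [ x <ᵇ b ]· x
letter-balance a b x a≡x⇒b≡x b≡x⇒a≡x with a ≟ x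
... | yes refl rewrite a≡x⇒b≡x refl | n<ᵇn≡false x = refl
... | no a≢x rewrite <ᵇ-flip a≢x | <ᵇ-flip {x} {b} (λ x≡b → a≢x (b≡x⇒a≡x (sym x≡b)))
  with a <ᵇ x | x <ᵇ b
... | true  | true  = +-identityʳ x
... | true  | false = refl
... | false | true  = refl
... | false | false = refl

<ᵇ-∸-+ : ∀ m n → [ m <ᵇ n ]· (n ∸ m) + [ m <ᵇ n ]· m ≡ [ m <ᵇ n ]· n
<ᵇ-∸-+ m n with m <ᵇ n | <ᵇ-reflects-< m n
... | true  | ofʸ m<n = m∸n+n≡m (<⇒≤ m<n)
... | false | _       = refl

m+n≡o⇒+o-+n≡+m : ∀ {m n o} → m + n ≡ o → + o - + n ≡ + m
m+n≡o⇒+o-+n≡+m {m} {n} refl = begin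
  + (m + n) - + n   ≡⟨ m-n≡m⊖n (m + n) n ⟩
  (m + n) ⊖ n       ≡⟨ ⊖-≥ (m≤n+m n m) ⟩
  + (m + n ∸ n)     ≡⟨ cong +_ (m+n∸n≡m m n) ⟩
  + m               ∎
  where open ≡-Reasoning

module _ {n : ℕ} (w : Permutation′ n) where

  private
    wˡ wʳ : Fin n → ℕ
    wˡ i = pos (w ⟨$⟩ˡ i)
    wʳ i = pos (w ⟨$⟩ʳ i)

    excedancePositions excedanceValues excedanceValuesByImage : ℕ
    excedancePositions  = ∑[ i < n ] [ pos i <ᵇ wʳ i ]· pos i
    excedanceValues     = ∑[ i < n ] [ pos i <ᵇ wʳ i ]· wʳ i
    excedanceValuesByImage = ∑[ j < n ] [ wˡ j <ᵇ pos j ]· pos j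

  dep+excedancePositions : dep w + excedancePositions ≡ excedanceValues
  dep+excedancePositions = begin
    dep w + excedancePositions
      ≡⟨ cong (_+ excedancePositions) (sum-filterᵇ-allFin (λ i → pos i <ᵇ wʳ i) (λ i → wʳ i ∸ pos i)) ⟩
    ∑[ i < n ] [ pos i <ᵇ wʳ i ]· (wʳ i ∸ pos i) + excedancePositions
      ≡⟨ sym (∑-distrib-+ (λ i → [ pos i <ᵇ wʳ i ]· (wʳ i ∸ pos i)) (λ i → [ pos i <ᵇ wʳ i ]· pos i)) ⟩
    ∑[ i < n ] ([ pos i <ᵇ wʳ i ]· (wʳ i ∸ pos i) + [ pos i <ᵇ wʳ i ]· pos i)
      ≡⟨ sum-cong-≗ (λ i → <ᵇ-∸-+ (pos i) (wʳ i)) ⟩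
    excedanceValues ∎
    where open ≡-Reasoning

  excedanceValues≡excedanceValuesByImage : excedanceValues ≡ excedanceValuesByImage
  excedanceValues≡excedanceValuesByImage =
    sym (∑-permute-graph w (λ k l → [ pos k <ᵇ pos l ]· pos l))

  excedanceValuesByImage+posSumU : excedanceValuesByImage + posSum isU (φ w) ≡ posSum isD (φ w) + excedancePositions
  excedanceValuesByImage+posSumU = begin
    excedanceValuesByImage + posSum isU (φ w)
      ≡⟨ cong (_+_ excedanceValuesByImage) (sum-filterᵇ-allFin (λ i → isU (φ w i)) pos) ⟩
    excedanceValuesByImage + ∑[ i < n ] [ isU (φ w i) ]· pos i
      ≡⟨ sym (∑-distrib-+ (λ i → [ wˡ i <ᵇ pos i ]· pos i) (λ i → [ isU (φ w i) ]· pos i)) ⟩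
    ∑[ i < n ] ([ wˡ i <ᵇ pos i ]· pos i + [ isU (φ w i) ]· pos i)
      ≡⟨ sum-cong-≗ (λ i → letter-balance (wˡ i) (wʳ i) (pos i) (fixedˡ i) (fixedʳ i)) ⟩
    ∑[ i < n ] ([ isD (φ w i) ]· pos i + [ pos i <ᵇ wʳ i ]· pos i)
      ≡⟨ ∑-distrib-+ (λ i → [ isD (φ w i) ]· pos i) (λ i → [ pos i <ᵇ wʳ i ]· pos i) ⟩
    ∑[ i < n ] [ isD (φ w i) ]· pos i + excedancePositions
      ≡⟨ cong (_+ excedancePositions) (sym (sum-filterᵇ-allFin (λ i → isD (φ w i)) pos)) ⟩
    posSum isD (φ w) + excedancePositions ∎
    where
    open ≡-Reasoning
    fixedˡ : ∀ i → wˡ i ≡ pos i → wʳ i ≡ pos i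
    fixedˡ i e = cong pos (fixedˡ⇒fixedʳ w (pos-injective e))
    fixedʳ : ∀ i → wʳ i ≡ pos i → wˡ i ≡ pos i
    fixedʳ i e = cong pos (fixedʳ⇒fixedˡ w (pos-injective e))

  dep+posSumU≡posSumD : dep w + posSum isU (φ w) ≡ posSum isD (φ w)
  dep+posSumU≡posSumD = +-cancelʳ-≡ excedancePositions _ _ (begin
    dep w + posSum isU (φ w) + excedancePositions   ≡⟨ xy∙z≈xz∙y (dep w) _ _ ⟩
    dep w + excedancePositions + posSum isU (φ w)   ≡⟨ cong (_+ posSum isU (φ w)) dep+excedancePositions ⟩
    excedanceValues + posSum isU (φ w)              ≡⟨ cong (_+ posSum isU (φ w)) excedanceValues≡excedanceValuesByImage ⟩
    excedanceValuesByImage + posSum isU (φ w)          ≡⟨ excedanceValuesByImage+posSumU ⟩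
    posSum isD (φ w) + excedancePositions           ∎)
    where open ≡-Reasoning

proposition3p1 : (n : ℕ) → n ≥ 1 → (w : Permutation′ n) →
    + dep w ≡ + posSum isD (φ w) - + posSum isU (φ w)
proposition3p1 _ _ w = sym (m+n≡o⇒+o-+n≡+m (dep+posSumU≡posSumD w))
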